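{- Let $n\geq 1$ and $m\geq 2n$ be integers and let $S$ be a subset of $[m]$ with $|S|=2n-1$. Then $\mathcal{F}_n^{S}$ is a maximal simplex (a simplex not properly contained in any other simplex) of the Vietoris–Rips complex $\mathcal{VR}(\mathcal{F}_n^{[m]};2(n-1))$.
   Context: $[m]=\{1,\dots,m\}$. For $S\subseteq[m]$ with $|S|\geq n$, $\mathcal{F}_n^{S}$ denotes the set of all $n$-element subsets of $S$, equipped with the metric $d(A,B)=|A\triangle B|$ (size of the symmetric difference). For a metric space $(X,d)$ and $r\geq 0$, the Vietoris–Rips complex $\mathcal{VR}(X;r)$ is the simplicial complex on vertex set $X$ whose simplices are the nonempty finite subsets $\sigma\subseteq X$ with $d(x,y)\leq r$ for all $x,y\in\sigma$. -}

module Defs where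

open import Data.Nat using (ℕ; _≤_; _+_)
open import Data.Fin.Subset using (Subset; _⊆_; _─_; ∣_∣)
open import Data.Product using (Σ; _×_)
open import Relation.Binary.PropositionalEquality using (_≡_)

-- A set of vertices (a family of subsets of [m] = Fin m), given as a predicate.
-- Since Subset m is finite, every such family is finite.
Family : ℕ → Set₁
Family m = Subset m → Set

symDiffDist : ∀ {m} → Subset m → Subset m → ℕ
symDiffDist A B = ∣ A ─ B ∣ + ∣ B ─ A ∣

𝓕 : ∀ {m} → ℕ → Subset m → Family m
𝓕 n S A = (A ⊆ S) × (∣ A ∣ ≡ n)

_⊑_ : ∀ {m} → Family m → Family m → Set
σ ⊑ τ = ∀ A → σ A → τ A

IsVRSimplex : ∀ {m} → Family m → ℕ → Family m → Set
IsVRSimplex X r σ =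
  (σ ⊑ X) × (Σ (Subset _) σ) × (∀ A B → σ A → σ B → symDiffDist A B ≤ r)

IsMaximalVRSimplex : ∀ {m} → Family m → ℕ → Family m → Set₁
IsMaximalVRSimplex X r σ =
  IsVRSimplex X r σ × (∀ (τ : Family _) → IsVRSimplex X r τ → σ ⊑ τ → τ ⊑ σ)

{-# OPTIONS --safe #-}
-- Two n-subsets A, B of a (2n-1)-set S satisfy |A ∖ B| ≤ |S| - |B| = n - 1, so
-- 𝓕_n^S has diameter at most 2(n-1). Conversely, if an n-set A is not contained
-- in S, then |S ∖ A| ≥ 2n - 1 - (n - 1) = n, so S ∖ A contains an n-set B at
-- distance |A| + |B| = 2n from A; thus no simplex of radius 2(n-1) can contain
-- both 𝓕_n^S and A.
module Submission where

open import Defs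
open import Data.Nat using (ℕ; _≤_; _∸_; _*_; _+_; suc)
open import Data.Fin.Subset using (Subset; ∣_∣; ⊤)
open import Relation.Binary.PropositionalEquality using (_≡_)

open import Data.Nat using (zero; s≤s; _<_)
open import Data.Nat.Properties
  using (+-suc; +-identityʳ; +-mono-≤; +-monoʳ-≤; +-cancelʳ-≤; m+n≤o⇒m≤o∸n;
         m+n∸n≡m; m≤n+m; ≤-reflexive; ≤-refl; <⇒≱; *-monoʳ-<; module ≤-Reasoning)
open import Data.Bool using (true; false)
open import Data.Vec using (_∷_; []; here)
open import Data.Fin.Subset using (_⊆_; _∩_; _∪_; _─_; ⊥)
open import Data.Fin.Subset.Properties
  using (drop-∷-⊆; out⊆; in⊆in; ⊥⊆; ∣⊥∣≡0; ⊆⊤; ⊆-trans; _⊆?_; p⊆q⇒∣p∣≤∣q∣;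
         ∩-comm; ∣p∩q∣≤∣p∣; x∈p∪q⁻; p─q⊆p)
open import Data.Product using (Σ; _×_; _,_; proj₂)
open import Data.Sum using ([_,_])
open import Relation.Binary.PropositionalEquality using (refl; sym; trans; cong; cong₂; subst; subst₂; module ≡-Reasoning)
open import Relation.Nullary using (¬_; yes; no; contradiction)

2*n≡n+n : ∀ n → 2 * n ≡ n + n
2*n≡n+n n = cong (n +_) (+-identityʳ n)

∣p─q∣+∣q∣≡∣p∪q∣ : ∀ {m} (p q : Subset m) → ∣ p ─ q ∣ + ∣ q ∣ ≡ ∣ p ∪ q ∣
∣p─q∣+∣q∣≡∣p∪q∣ []          []          = refl
∣p─q∣+∣q∣≡∣p∪q∣ (true  ∷ p) (true  ∷ q) = trans (+-suc ∣ p ─ q ∣ ∣ q ∣) (cong suc (∣p─q∣+∣q∣≡∣p∪q∣ p q))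
∣p─q∣+∣q∣≡∣p∪q∣ (false ∷ p) (true  ∷ q) = trans (+-suc ∣ p ─ q ∣ ∣ q ∣) (cong suc (∣p─q∣+∣q∣≡∣p∪q∣ p q))
∣p─q∣+∣q∣≡∣p∪q∣ (true  ∷ p) (false ∷ q) = cong suc (∣p─q∣+∣q∣≡∣p∪q∣ p q)
∣p─q∣+∣q∣≡∣p∪q∣ (false ∷ p) (false ∷ q) = ∣p─q∣+∣q∣≡∣p∪q∣ p q

∣p─q∣+∣p∩q∣≡∣p∣ : ∀ {m} (p q : Subset m) → ∣ p ─ q ∣ + ∣ p ∩ q ∣ ≡ ∣ p ∣
∣p─q∣+∣p∩q∣≡∣p∣ []          []          = refl
∣p─q∣+∣p∩q∣≡∣p∣ (true  ∷ p) (true  ∷ q) = trans (+-suc ∣ p ─ q ∣ ∣ p ∩ q ∣) (cong suc (∣p─q∣+∣p∩q∣≡∣p∣ p q))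
∣p─q∣+∣p∩q∣≡∣p∣ (true  ∷ p) (false ∷ q) = cong suc (∣p─q∣+∣p∩q∣≡∣p∣ p q)
∣p─q∣+∣p∩q∣≡∣p∣ (false ∷ p) (true  ∷ q) = ∣p─q∣+∣p∩q∣≡∣p∣ p q
∣p─q∣+∣p∩q∣≡∣p∣ (false ∷ p) (false ∷ q) = ∣p─q∣+∣p∩q∣≡∣p∣ p q

∣p─q∣≤∣r∣∸∣q∣ : ∀ {m} {p q r : Subset m} → p ⊆ r → q ⊆ r → ∣ p ─ q ∣ ≤ ∣ r ∣ ∸ ∣ q ∣
∣p─q∣≤∣r∣∸∣q∣ {p = p} {q} {r} p⊆r q⊆r = m+n≤o⇒m≤o∸n ∣ p ─ q ∣ (begin
  ∣ p ─ q ∣ + ∣ q ∣ ≡⟨ ∣p─q∣+∣q∣≡∣p∪q∣ p q ⟩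
  ∣ p ∪ q ∣         ≤⟨ p⊆q⇒∣p∣≤∣q∣ (λ x∈p∪q → [ p⊆r , q⊆r ] (x∈p∪q⁻ p q x∈p∪q)) ⟩
  ∣ r ∣             ∎)
  where open ≤-Reasoning

p⊈q⇒∣p∩q∣<∣p∣ : ∀ {m} {p q : Subset m} → ¬ p ⊆ q → ∣ p ∩ q ∣ < ∣ p ∣
p⊈q⇒∣p∩q∣<∣p∣ {p = []}        {[]}        p⊈q = contradiction (λ ()) p⊈q
p⊈q⇒∣p∩q∣<∣p∣ {p = false ∷ p} {_ ∷ q}     p⊈q = p⊈q⇒∣p∩q∣<∣p∣ (λ p⊆q → p⊈q (out⊆ p⊆q))
p⊈q⇒∣p∩q∣<∣p∣ {p = true  ∷ p} {false ∷ q} p⊈q = s≤s (∣p∩q∣≤∣p∣ p q)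
p⊈q⇒∣p∩q∣<∣p∣ {p = true  ∷ p} {true  ∷ q} p⊈q = s≤s (p⊈q⇒∣p∩q∣<∣p∣ (λ p⊆q → p⊈q (in⊆in p⊆q)))

p⊆q─r⇒p∩r≡⊥ : ∀ {m} {p q r : Subset m} → p ⊆ q ─ r → p ∩ r ≡ ⊥
p⊆q─r⇒p∩r≡⊥ {p = []}        {[]}    {[]}        _     = refl
p⊆q─r⇒p∩r≡⊥ {p = false ∷ p} {_ ∷ q} {_ ∷ r}     p⊆q─r = cong (false ∷_) (p⊆q─r⇒p∩r≡⊥ (drop-∷-⊆ p⊆q─r))
p⊆q─r⇒p∩r≡⊥ {p = true  ∷ p} {_ ∷ q} {false ∷ r} p⊆q─r = cong (false ∷_) (p⊆q─r⇒p∩r≡⊥ (drop-∷-⊆ p⊆q─r))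
p⊆q─r⇒p∩r≡⊥ {p = true  ∷ p} {_ ∷ q} {true  ∷ r} p⊆q─r with p⊆q─r here
... | ()

p∩q≡⊥⇒∣p─q∣≡∣p∣ : ∀ {m} (p q : Subset m) → p ∩ q ≡ ⊥ → ∣ p ─ q ∣ ≡ ∣ p ∣
p∩q≡⊥⇒∣p─q∣≡∣p∣ {m} p q p∩q≡⊥ = begin
  ∣ p ─ q ∣                ≡⟨ sym (+-identityʳ _) ⟩
  ∣ p ─ q ∣ + 0            ≡⟨ cong (∣ p ─ q ∣ +_) (sym (∣⊥∣≡0 m)) ⟩
  ∣ p ─ q ∣ + ∣ ⊥ {n = m} ∣ ≡⟨ cong (λ s → ∣ p ─ q ∣ + ∣ s ∣) (sym p∩q≡⊥) ⟩
  ∣ p ─ q ∣ + ∣ p ∩ q ∣    ≡⟨ ∣p─q∣+∣p∩q∣≡∣p∣ p q ⟩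
  ∣ p ∣                    ∎
  where open ≡-Reasoning

symDiffDist-disjoint : ∀ {m} {A B : Subset m} → A ∩ B ≡ ⊥ → symDiffDist A B ≡ ∣ A ∣ + ∣ B ∣
symDiffDist-disjoint {A = A} {B} A∩B≡⊥ =
  cong₂ _+_ (p∩q≡⊥⇒∣p─q∣≡∣p∣ A B A∩B≡⊥) (p∩q≡⊥⇒∣p─q∣≡∣p∣ B A (trans (∩-comm B A) A∩B≡⊥))

𝓕-nonempty : ∀ {m} {k} {S : Subset m} → k ≤ ∣ S ∣ → Σ (Subset m) (𝓕 k S)
𝓕-nonempty {m} {zero} _ = ⊥ , ⊥⊆ , ∣⊥∣≡0 m
𝓕-nonempty {k = suc k} {true ∷ S} (s≤s k≤∣S∣) with 𝓕-nonempty k≤∣S∣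
... | A , A⊆S , ∣A∣≡k = true ∷ A , in⊆in A⊆S , cong suc ∣A∣≡k
𝓕-nonempty {k = suc k} {false ∷ S} k<∣S∣ with 𝓕-nonempty k<∣S∣
... | A , A⊆S , ∣A∣≡k = false ∷ A , out⊆ A⊆S , ∣A∣≡k

𝓕-mono : ∀ {m} {n} {S T : Subset m} → S ⊆ T → 𝓕 n S ⊑ 𝓕 n T
𝓕-mono S⊆T A (A⊆S , ∣A∣≡n) = ⊆-trans A⊆S S⊆T , ∣A∣≡n

𝓕-diameter : ∀ {m} n {S A B : Subset m} → 𝓕 n S A → 𝓕 n S B → symDiffDist A B ≤ 2 * (∣ S ∣ ∸ n)
𝓕-diameter n {S} {A} {B} (A⊆S , ∣A∣≡n) (B⊆S , ∣B∣≡n) = begin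
  ∣ A ─ B ∣ + ∣ B ─ A ∣ ≤⟨ +-mono-≤ (∣p─q∣≤k B⊆S A⊆S ∣B∣≡n) (∣p─q∣≤k A⊆S B⊆S ∣A∣≡n) ⟩
  k + k                 ≡⟨ sym (2*n≡n+n k) ⟩
  2 * k                 ∎
  where
  open ≤-Reasoning
  k = ∣ S ∣ ∸ n
  ∣p─q∣≤k : ∀ {p q} → q ⊆ S → p ⊆ S → ∣ q ∣ ≡ n → ∣ p ─ q ∣ ≤ k
  ∣p─q∣≤k q⊆S p⊆S ∣q∣≡n = subst (λ j → _ ≤ ∣ S ∣ ∸ j) ∣q∣≡n (∣p─q∣≤∣r∣∸∣q∣ p⊆S q⊆S)

𝓕-isVRSimplex : ∀ {m} n {S T : Subset m} → S ⊆ T → n ≤ ∣ S ∣ →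
                IsVRSimplex (𝓕 n T) (2 * (∣ S ∣ ∸ n)) (𝓕 n S)
𝓕-isVRSimplex n S⊆T n≤∣S∣ = 𝓕-mono S⊆T , 𝓕-nonempty n≤∣S∣ , λ _ _ → 𝓕-diameter n

𝓕-far-member : ∀ {m} n {S A : Subset m} → 2 * n ≤ suc ∣ S ∣ → ∣ A ∣ ≡ n → ¬ A ⊆ S →
               Σ (Subset m) λ B → 𝓕 n S B × symDiffDist A B ≡ 2 * n
𝓕-far-member n {S} {A} 2n≤1+∣S∣ ∣A∣≡n A⊈S with 𝓕-nonempty n≤∣S─A∣
  where
  n≤∣S─A∣ : n ≤ ∣ S ─ A ∣
  n≤∣S─A∣ = +-cancelʳ-≤ n n ∣ S ─ A ∣ (begin
    n + n                          ≡⟨ sym (2*n≡n+n n) ⟩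
    2 * n                          ≤⟨ 2n≤1+∣S∣ ⟩
    suc ∣ S ∣                       ≡⟨ cong suc (sym (∣p─q∣+∣p∩q∣≡∣p∣ S A)) ⟩
    suc (∣ S ─ A ∣ + ∣ S ∩ A ∣)      ≡⟨ sym (+-suc ∣ S ─ A ∣ ∣ S ∩ A ∣) ⟩
    ∣ S ─ A ∣ + suc ∣ S ∩ A ∣        ≤⟨ +-monoʳ-≤ ∣ S ─ A ∣ ∣S∩A∣<n ⟩
    ∣ S ─ A ∣ + n                  ∎)
    where
    open ≤-Reasoning
    ∣S∩A∣<n : ∣ S ∩ A ∣ < n
    ∣S∩A∣<n = subst₂ _<_ (cong ∣_∣ (∩-comm A S)) ∣A∣≡n (p⊈q⇒∣p∩q∣<∣p∣ A⊈S)
... | B , B⊆S─A , ∣B∣≡n = B , (⊆-trans B⊆S─A (p─q⊆p S A) , ∣B∣≡n) , (begin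
  symDiffDist A B ≡⟨ symDiffDist-disjoint (trans (∩-comm A B) (p⊆q─r⇒p∩r≡⊥ B⊆S─A)) ⟩
  ∣ A ∣ + ∣ B ∣   ≡⟨ cong₂ _+_ ∣A∣≡n ∣B∣≡n ⟩
  n + n           ≡⟨ sym (2*n≡n+n n) ⟩
  2 * n           ∎)
  where open ≡-Reasoning

𝓕-maximal : ∀ {m} n {r} {S T : Subset m} → 2 * n ≤ suc ∣ S ∣ → r < 2 * n →
            (τ : Family m) → IsVRSimplex (𝓕 n T) r τ → 𝓕 n S ⊑ τ → τ ⊑ 𝓕 n S
𝓕-maximal n {r} {S} 2n≤1+∣S∣ r<2n τ (τ⊑𝓕nT , _ , τ-diam) 𝓕nS⊑τ A A∈τ with A ⊆? S
... | yes A⊆S = A⊆S , proj₂ (τ⊑𝓕nT A A∈τ)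
... | no A⊈S with 𝓕-far-member n 2n≤1+∣S∣ (proj₂ (τ⊑𝓕nT A A∈τ)) A⊈S
...   | B , B∈𝓕nS , dAB≡2n =
  contradiction (subst (_≤ r) dAB≡2n (τ-diam A B A∈τ (𝓕nS⊑τ B B∈𝓕nS))) (<⇒≱ r<2n)

lemma3p1 : (n m : ℕ) → 1 ≤ n → 2 * n ≤ m → (S : Subset m) → ∣ S ∣ ≡ 2 * n ∸ 1 →
    IsMaximalVRSimplex (𝓕 n ⊤) (2 * (n ∸ 1)) (𝓕 n S)
lemma3p1 n@(suc k) m _ _ S ∣S∣≡2n∸1 =
  subst (λ j → IsVRSimplex (𝓕 n ⊤) (2 * j) (𝓕 n S)) ∣S∣∸n≡k (𝓕-isVRSimplex n ⊆⊤ n≤∣S∣) ,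
  𝓕-maximal n (≤-reflexive (cong suc (sym ∣S∣≡2n∸1))) (*-monoʳ-< 2 ≤-refl)
  where
  ∣S∣≡k+n : ∣ S ∣ ≡ k + n
  ∣S∣≡k+n = trans ∣S∣≡2n∸1 (cong (λ j → k + suc j) (+-identityʳ k))
  n≤∣S∣ : n ≤ ∣ S ∣
  n≤∣S∣ = subst (n ≤_) (sym ∣S∣≡k+n) (m≤n+m n k)
  ∣S∣∸n≡k : ∣ S ∣ ∸ n ≡ k
  ∣S∣∸n≡k = trans (cong (_∸ n) ∣S∣≡k+n) (m+n∸n≡m k n)
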